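{- Let $p$ be a prime and let $(h_1,\dots,h_n)$ be a MuM position with modulus $p$ whose heap product $P = \prod_{i=1}^n h_i$ satisfies $P \not\equiv 1 \pmod p$. If at least one heap satisfies $h_j > p$, then there exists a legal move to a position whose heap product is $\equiv 1 \pmod p$.
   Context: MuM with prime modulus $p$: a position is a finite multiset of heaps, each a positive integer not divisible by $p$. A legal move consists of choosing a heap $h_i > 1$ and replacing it by $h_i' = h_i - r$, where the integer $r$ satisfies $1 \le r < p$, $r < h_i$, and $h_i'$ is not divisible by $p$. A position is called losing if its heap product is $\equiv 1 \pmod p$ and winning otherwise. -}

module Defs where

open import Data.Nat using (ℕ; zero; suc; _+_; _*_; _∸_; _<_; _≤_; _>_; NonZero)
open import Data.Nat.Divisibility using (_∣_)
open import Data.Nat.DivMod using (_%_)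
open import Data.Nat.Primality using (Prime; prime⇒nonZero)
open import Data.Fin using (Fin; toℕ)
open import Data.List using (List; length; lookup; updateAt)
open import Data.Nat.ListAction using (product)
open import Data.List.Relation.Unary.All using (All)
open import Data.Product using (Σ; _×_; ∃-syntax)
open import Relation.Nullary using (¬_)
open import Relation.Binary.PropositionalEquality using (_≡_)

-- A MuM position with modulus p: a finite multiset of heaps (represented as a
-- list; order is irrelevant), each heap a positive integer not divisible by p.
IsPosition : ℕ → List ℕ → Set
IsPosition p hs = All (λ h → 0 < h × ¬ (p ∣ h)) hs

ProductIsOneMod : (p : ℕ) → Prime p → List ℕ → Set
ProductIsOneMod p pr hs = (product hs % p) {{prime⇒nonZero pr}} ≡ (1 % p) {{prime⇒nonZero pr}}

LegalMove : ℕ → List ℕ → List ℕ → Set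
LegalMove p hs hs' =
  ∃[ i ] ∃[ r ]
    ( 1 < lookup hs i
    × 1 ≤ r × r < p × r < lookup hs i
    × ¬ (p ∣ (lookup hs i ∸ r))
    × hs' ≡ updateAt hs i (λ h → h ∸ r) )

{-# OPTIONS --safe #-}
module Submission where

-- Write the heap product as h * Q, where h is a heap exceeding p.  Since p is
-- prime and divides no heap, Q has an inverse t modulo p, and it suffices to
-- lower h to a number ≡ t (mod p).  The position is winning, so h ≢ t (mod p);
-- hence some r with 1 ≤ r < p does this, and h ≥ p keeps h - r positive.

open import Defs
open import Data.Fin using (zero; suc)
open import Data.List using (List; _∷_; lookup; updateAt; removeAt)
open import Data.List.Relation.Unary.All using (All; []; _∷_)
import Data.List.Relation.Unary.All as All
open import Data.Nat using (ℕ; suc; _+_; _*_; _∸_; _<_; _≤_; _>_; NonZero; nonTrivial⇒n>1)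
open import Data.Nat.Coprimality using (Coprime; coprime-Bézout)
import Data.Nat.Coprimality as Coprime
open import Data.Nat.DivMod
open import Data.Nat.Divisibility using (_∣_; _∤_; ∣-trans; m∣m*n; n∣m*n; ∣1⇒≡1; n∣m⇒m%n≡0; m%n≡0⇒n∣m)
open import Data.Nat.GCD using (module Bézout)
open import Data.Nat.ListAction using (product)
open import Data.Nat.Primality
  using (Prime; ¬prime[1]; prime⇒nonZero; prime⇒nonTrivial; prime⇒irreducible; euclidsLemma)
open import Data.Nat.Properties
open import Algebra.Properties.CommutativeSemigroup *-commutativeSemigroup
  using () renaming (x∙yz≈y∙xz to m*[n*o]≡n*[m*o])
open import Algebra.Properties.CommutativeSemigroup +-commutativeSemigroup
  using () renaming (xy∙z≈xz∙y to m+n+o≡m+o+n)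
open import Data.Nat.Tactic.RingSolver using (solve-∀)
open import Data.Product using (_×_; _,_; proj₂; ∃-syntax)
open import Data.Sum using (inj₁; inj₂; [_,_]′)
open import Function using (_∘_)
open import Relation.Binary.Definitions using (tri<; tri≈; tri>)
open import Relation.Binary.PropositionalEquality
open import Relation.Nullary using (¬_; contradiction)
open ≡-Reasoning

product-removeAt : ∀ (xs : List ℕ) i → product xs ≡ lookup xs i * product (removeAt xs i)
product-removeAt (x ∷ xs) zero    = refl
product-removeAt (x ∷ xs) (suc i) =
  trans (cong (x *_) (product-removeAt xs i)) (m*[n*o]≡n*[m*o] x (lookup xs i) _)

product-updateAt : ∀ (xs : List ℕ) i (f : ℕ → ℕ) →
                   product (updateAt xs i f) ≡ f (lookup xs i) * product (removeAt xs i)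
product-updateAt (x ∷ xs) zero    f = refl
product-updateAt (x ∷ xs) (suc i) f =
  trans (cong (x *_) (product-updateAt xs i f)) (m*[n*o]≡n*[m*o] x (f (lookup xs i)) _)

coprime⇒∃inverse : ∀ {q n} .{{_ : NonZero n}} → Coprime q n → ∃[ t ] (t * q) % n ≡ 1 % n
coprime⇒∃inverse {q} {n@(suc m)} coprime with coprime-Bézout coprime
... | Bézout.+- x y eq = x , (begin
  (x * q) % n       ≡⟨ %-congˡ eq ⟨
  (1 + y * n) % n   ≡⟨ [m+kn]%n≡m%n 1 y n ⟩
  1 % n             ∎)
-- Here x * q ≡ -1 (mod n), so (n - 1) * x inverts q.
... | Bézout.-+ x y eq = m * x , (begin
  (m * x * q) % n       ≡⟨ [m+n]%n≡m%n (m * x * q) n ⟨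
  (m * x * q + n) % n   ≡⟨ %-congˡ m*x*q+n≡1+m*y*n ⟩
  (1 + m * y * n) % n   ≡⟨ [m+kn]%n≡m%n 1 (m * y) n ⟩
  1 % n                 ∎)
  where
  m*x*q+n≡1+m*y*n : m * x * q + n ≡ 1 + m * y * n
  m*x*q+n≡1+m*y*n = begin
    m * x * q + suc m      ≡⟨ ring-identity m x q ⟩
    1 + m * (1 + x * q)    ≡⟨ cong (λ z → 1 + m * z) eq ⟩
    1 + m * (y * n)        ≡⟨ cong suc (*-assoc m y n) ⟨
    1 + m * y * n          ∎
    where
    ring-identity : ∀ m x q → m * x * q + suc m ≡ 1 + m * (1 + x * q)
    ring-identity = solve-∀

module _ {n : ℕ} .{{_ : NonZero n}} where

  %-cong-*ʳ : ∀ a b q → a % n ≡ b % n → (a * q) % n ≡ (b * q) % n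
  %-cong-*ʳ a b q a≡b = begin
    (a * q) % n                 ≡⟨ %-distribˡ-* a q n ⟩
    ((a % n) * (q % n)) % n     ≡⟨ cong (λ x → (x * (q % n)) % n) a≡b ⟩
    ((b % n) * (q % n)) % n     ≡⟨ %-distribˡ-* b q n ⟨
    (b * q) % n                 ∎

  [c+r+kn∸r]%n≡c : ∀ {c} r k → c < n → ((c + r) + k * n ∸ r) % n ≡ c
  [c+r+kn∸r]%n≡c {c} r k c<n = begin
    ((c + r) + k * n ∸ r) % n  ≡⟨ %-congˡ (cong (_∸ r) (m+n+o≡m+o+n c r (k * n))) ⟩
    ((c + k * n) + r ∸ r) % n  ≡⟨ %-congˡ (m+n∸n≡m (c + k * n) r) ⟩
    (c + k * n) % n            ≡⟨ [m+kn]%n≡m%n c k n ⟩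
    c % n                      ≡⟨ m<n⇒m%n≡m c<n ⟩
    c                          ∎

  ∸-reaches-residue : ∀ {h c} → n ≤ h → c < n → h % n ≢ c →
                      ∃[ r ] 1 ≤ r × r < n × (h ∸ r) % n ≡ c
  ∸-reaches-residue {h} {c} n≤h c<n h%n≢c with <-cmp c (h % n)
  ... | tri≈ _ c≡a _ = contradiction (sym c≡a) h%n≢c
  ... | tri< c<a _ _ =
    a ∸ c , m<n⇒0<n∸m c<a , ≤-<-trans (m∸n≤m a c) (m%n<n h n) ,
    subst (λ x → (x ∸ (a ∸ c)) % n ≡ c) (sym h≡) ([c+r+kn∸r]%n≡c (a ∸ c) (h / n) c<n)
    where
    a : ℕ
    a = h % n
    h≡ : h ≡ (c + (a ∸ c)) + h / n * n
    h≡ = trans (m≡m%n+[m/n]*n h n) (cong (_+ h / n * n) (sym (m+[n∸m]≡n (<⇒≤ c<a))))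
  -- The target lies above h's residue, so descend into the previous block of n;
  -- that block exists because n ≤ h.
  ... | tri> _ _ a<c =
    n ∸ d , m<n⇒0<n∸m d<n , ∸-monoʳ-< (m<n⇒0<n∸m a<c) (<⇒≤ d<n) ,
    subst (λ x → (x ∸ (n ∸ d)) % n ≡ c) (sym h≡) ([c+r+kn∸r]%n≡c (n ∸ d) k c<n)
    where
    a d k : ℕ
    a = h % n
    d = c ∸ a
    k = (h ∸ n) / n
    d<n : d < n
    d<n = ≤-<-trans (m∸n≤m c a) c<n
    h≡ : h ≡ (c + (n ∸ d)) + k * n
    h≡ = begin
      h                           ≡⟨ m≡m%n+[m/n]*n h n ⟩
      a + h / n * n               ≡⟨ cong (λ z → a + z * n) (m/n≡1+[m∸n]/n n≤h) ⟩
      a + (n + k * n)             ≡⟨ +-assoc a n (k * n) ⟨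
      (a + n) + k * n             ≡⟨ cong (λ z → (a + z) + k * n) (m+[n∸m]≡n (<⇒≤ d<n)) ⟨
      (a + (d + (n ∸ d))) + k * n ≡⟨ cong (_+ k * n) (+-assoc a d (n ∸ d)) ⟨
      ((a + d) + (n ∸ d)) + k * n ≡⟨ cong (λ z → (z + (n ∸ d)) + k * n) (m+[n∸m]≡n (<⇒≤ a<c)) ⟩
      (c + (n ∸ d)) + k * n       ∎

module _ {p : ℕ} (pr : Prime p) where

  private instance
    p≢0 : NonZero p
    p≢0 = prime⇒nonZero pr

  ∤1 : p ∤ 1
  ∤1 p∣1 = ¬prime[1] (subst Prime (∣1⇒≡1 p∣1) pr)

  ∤-product : ∀ {xs} → All (p ∤_) xs → p ∤ product xs
  ∤-product []                  = ∤1
  ∤-product (p∤x ∷ p∤xs) p∣x*xs = [ p∤x , ∤-product p∤xs ]′ (euclidsLemma _ _ pr p∣x*xs)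

  ∤⇒coprime : ∀ {q} → p ∤ q → Coprime p q
  ∤⇒coprime p∤q (d∣p , d∣q) with prime⇒irreducible pr d∣p
  ... | inj₁ d≡1 = d≡1
  ... | inj₂ d≡p = contradiction (subst (_∣ _) d≡p d∣q) p∤q

  %≡1⇒∤ : ∀ {m} → m % p ≡ 1 % p → p ∤ m
  %≡1⇒∤ {m} m≡1 p∣m = ∤1 (m%n≡0⇒n∣m 1 p (trans (sym m≡1) (n∣m⇒m%n≡0 m p p∣m)))

  ∸-reaches-inverse : ∀ {h q} → p ∤ q → p ≤ h → (h * q) % p ≢ 1 % p →
                      ∃[ r ] 1 ≤ r × r < p × p ∤ (h ∸ r) × ((h ∸ r) * q) % p ≡ 1 % p
  ∸-reaches-inverse {h} {q} p∤q p≤h hq≢1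
    with t , tq≡1 ← coprime⇒∃inverse (Coprime.sym (∤⇒coprime p∤q))
    with r , 1≤r , r<p , h∸r≡t ← ∸-reaches-residue p≤h (m%n<n t p)
                                   (hq≢1 ∘ λ h≡t → trans (%-cong-*ʳ h t q h≡t) tq≡1)
    = r , 1≤r , r<p , %≡1⇒∤ [h∸r]q≡1 ∘ (λ p∣h∸r → ∣-trans p∣h∸r (m∣m*n q)) , [h∸r]q≡1
    where
    [h∸r]q≡1 : ((h ∸ r) * q) % p ≡ 1 % p
    [h∸r]q≡1 = trans (%-cong-*ʳ (h ∸ r) t q h∸r≡t) tq≡1

proposition1 : (p : ℕ) (pr : Prime p) (hs : List ℕ) →
    IsPosition p hs →
    ¬ ProductIsOneMod p pr hs →
    (∃[ j ] lookup hs j > p) →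
    ∃[ hs' ] (LegalMove p hs hs' × ProductIsOneMod p pr hs')
proposition1 p pr hs pos notOne (j , p<h) =
  let r , 1≤r , r<p , p∤h∸r , [h∸r]Q≡1 = ∸-reaches-inverse pr p∤Q (<⇒≤ p<h) hQ≢1
  in updateAt hs j (_∸ r)
   , (j , r , <-trans 1<p p<h , 1≤r , r<p , <-trans r<p p<h , p∤h∸r , refl)
   , trans (%-congˡ (product-updateAt hs j (_∸ r))) [h∸r]Q≡1
  where
  instance
    p≢0 : NonZero p
    p≢0 = prime⇒nonZero pr
  h Q : ℕ
  h = lookup hs j
  Q = product (removeAt hs j)
  1<p : 1 < p
  1<p = nonTrivial⇒n>1 p {{prime⇒nonTrivial pr}}
  p∤Q : p ∤ Q
  p∤Q p∣Q = ∤-product pr (All.map proj₂ pos)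
              (subst (p ∣_) (sym (product-removeAt hs j)) (∣-trans p∣Q (n∣m*n h)))
  hQ≢1 : (h * Q) % p ≢ 1 % p
  hQ≢1 = notOne ∘ trans (%-congˡ (product-removeAt hs j))
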